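{- Let $\mathcal{N}=(\mathcal{G},V^B,\mathcal{P})$ be a network graph and let $x$ be a non-separable internal vertex. Let $A$ be a Boolean predicate defined on the pairs $(b,b')$ of boundary vertices with $x\in\mathcal{P}(b,b')$. Assume $A$ is non-constant, i.e., true on some such pair and false on some other. Define $S_x^1=\{b\in S_x:\exists b'\in R_x\,[x\in\mathcal{P}(b,b')\wedge A(b,b')]\}$, $S_x^2=\{b\in S_x:\exists b'\in R_x\,[x\in\mathcal{P}(b,b')\wedge \neg A(b,b')]\}$, $R_x^1=\{b'\in R_x:\exists b\in S_x\,[x\in\mathcal{P}(b,b')\wedge A(b,b')]\}$, $R_x^2=\{b'\in R_x:\exists b\in S_x\,[x\in\mathcal{P}(b,b')\wedge \neg A(b,b')]\}$. Then $S_x^1\cap S_x^2$ and $R_x^1\cap R_x^2$ cannot both be empty.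
   Context: A network graph $\mathcal{N}=(\mathcal{G},V^B,\mathcal{P})$ consists of the following data. - A finite directed graph $\mathcal{G}=(V,E,\mathcal{W})$ with positive edge weights, no loops and no multiple edges. - A subset $V^B\subset V$ of boundary vertices. The vertices in $V^I=V\setminus V^B$ are called internal. - For each ordered pair $b\neq b'$ in $V^B$, a fixed simple directed path $\mathcal{P}(b,b')$ from $b$ to $b'$. The paths satisfy the tree consistency property: any intersection $\mathcal{P}(b_1,b_1')\cap\mathcal{P}(b_2,b_2')$ is connected. For an internal vertex $x$, define $S_x=\{b\in V^B:\exists\hat b,\ x\in\mathcal{P}(b,\hat b)\}$ and $R_x=\{\hat b\in V^B:\exists b,\ x\in\mathcal{P}(b,\hat b)\}$. The vertex $x$ is separable if there are partitions $S_x=S_x^1\cup S_x^2$ and $R_x=R_x^1\cup R_x^2$ into disjoint non-empty sets such that $x\notin\mathcal{P}(b,\hat b)$ whenever $b\in S_x^j$ and $\hat b\in R_x^{j'}$ with $j\neq j'$. The vertex is non-separable otherwise. -}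

module Defs where

open import Data.Nat using (ℕ)
open import Data.Fin using (Fin)
open import Data.Bool using (Bool; true; false)
open import Data.Rational using (ℚ; Positive)
open import Data.List using (List; []; _∷_; _++_; head; last)
open import Data.List.Membership.Propositional using (_∈_; _∉_)
open import Data.List.Relation.Unary.Unique.Propositional using (Unique)
open import Data.Maybe using (just)
open import Data.Product using (Σ; _×_; ∃; ∃-syntax; _,_)
open import Data.Sum using (_⊎_)
open import Relation.Nullary using (¬_)
open import Relation.Binary.PropositionalEquality using (_≡_; _≢_)

-- Finite directed graph with positive edge weights, vertex set Fin n.
-- Edges form a relation (so no multiple edges); loops are excluded.

record Graph (n : ℕ) : Set₁ where
  field
    Edge      : Fin n → Fin n → Set
    noLoop    : ∀ v → ¬ Edge v v
    weight    : Fin n → Fin n → ℚ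
    weightPos : ∀ u v → Edge u v → Positive (weight u v)

data Walk {n : ℕ} (E : Fin n → Fin n → Set) : List (Fin n) → Set where
  walk-[]  : Walk E []
  walk-[x] : ∀ x → Walk E (x ∷ [])
  walk-∷   : ∀ x y ys → E x y → Walk E (y ∷ ys) → Walk E (x ∷ y ∷ ys)

record SimplePath {n : ℕ} (G : Graph n) (b b' : Fin n) (p : List (Fin n)) : Set where
  field
    isWalk : Walk (Graph.Edge G) p
    simple : Unique p
    starts : head p ≡ just b
    ends   : last p ≡ just b'

-- v lies on the segment of p from an occurrence of u to a later
-- (or the same) occurrence of w
Between : {A : Set} → A → A → A → List A → Set
Between u v w p =
  ∃[ l₁ ] ∃[ m ] ∃[ l₂ ] (p ≡ l₁ ++ (u ∷ m) ++ (w ∷ l₂) × v ∈ (u ∷ m) ++ (w ∷ []))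
  ⊎ (u ≡ v × v ≡ w × v ∈ p)

-- The common vertices of p and q form a connected piece of each path:
-- any vertex of one path lying between two common vertices is common.
ConnectedIntersection : {A : Set} → List A → List A → Set
ConnectedIntersection p q =
  (∀ u v w → u ∈ p → u ∈ q → w ∈ p → w ∈ q → Between u v w p → v ∈ q) ×
  (∀ u v w → u ∈ p → u ∈ q → w ∈ p → w ∈ q → Between u v w q → v ∈ p)

record NetworkGraph (n : ℕ) : Set₁ where
  field
    G        : Graph n
    boundary : Fin n → Bool
    path     : Fin n → Fin n → List (Fin n)
    pathOK   : ∀ b b' → boundary b ≡ true → boundary b' ≡ true → b ≢ b' →
               SimplePath G b b' (path b b')
    treeConsistent :
      ∀ b₁ b₁' b₂ b₂' →
      boundary b₁ ≡ true → boundary b₁' ≡ true → b₁ ≢ b₁' →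
      boundary b₂ ≡ true → boundary b₂' ≡ true → b₂ ≢ b₂' →
      ConnectedIntersection (path b₁ b₁') (path b₂ b₂')

module _ {n : ℕ} (N : NetworkGraph n) where
  open NetworkGraph N

  IsBoundary : Fin n → Set
  IsBoundary v = boundary v ≡ true

  Internal : Fin n → Set
  Internal v = boundary v ≡ false

  OnPath : Fin n → Fin n → Fin n → Set
  OnPath x b b' = IsBoundary b × IsBoundary b' × b ≢ b' × x ∈ path b b'

  InS : Fin n → Fin n → Set
  InS x b = ∃[ b' ] OnPath x b b'

  InR : Fin n → Fin n → Set
  InR x b' = ∃[ b ] OnPath x b b'

  -- x is separable: partitions S_x = S¹ ∪ S², R_x = R¹ ∪ R² into disjoint
  -- nonempty parts (encoded by Bool labels) such that x ∉ 𝒫(b,b̂)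
  -- whenever b ∈ S^j, b̂ ∈ R^{j'}, j ≠ j'.
  Separable : Fin n → Set
  Separable x =
    Σ (Fin n → Bool) λ σ → Σ (Fin n → Bool) λ ρ →
      (∃[ b ] (InS x b × σ b ≡ true)) × (∃[ b ] (InS x b × σ b ≡ false)) ×
      (∃[ b ] (InR x b × ρ b ≡ true)) × (∃[ b ] (InR x b × ρ b ≡ false)) ×
      (∀ b b' → InS x b → InR x b' → σ b ≢ ρ b' → ¬ OnPath x b b')

  NonSeparable : Fin n → Set
  NonSeparable x = ¬ Separable x

  S¹ S² R¹ R² : Fin n → (Fin n → Fin n → Bool) → Fin n → Set
  S¹ x A b  = InS x b × ∃[ b' ] (InR x b' × OnPath x b b' × A b b' ≡ true)
  S² x A b  = InS x b × ∃[ b' ] (InR x b' × OnPath x b b' × A b b' ≡ false)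
  R¹ x A b' = InR x b' × ∃[ b ] (InS x b × OnPath x b b' × A b b' ≡ true)
  R² x A b' = InR x b' × ∃[ b ] (InS x b × OnPath x b b' × A b b' ≡ false)

module Submission where

-- The lemma is a purely combinatorial fact about a Boolean
-- labelling A of the pairs (b,b') with x ∈ 𝒫(b,b').  If no source b is
-- "mixed" (carries both an A-true and an A-false pair), then A(b,b') depends
-- only on b: it equals the row label σ b, which records whether some pair
-- starting at b is A-true.  Dually, if no receiver b' is mixed, A(b,b') equals
-- the column label ρ b'.  Hence, if both S¹∩S² and R¹∩R² were empty, then
-- σ b = A(b,b') = ρ b' for every pair through x, so the labels σ and ρ
-- split S_x and R_x into parts with no pair through x crossing between them;
-- the A-true and A-false pairs make all four parts non-empty.  This would
-- make x separable, contradicting the hypothesis.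

open import Defs
open import Data.Nat using (ℕ)
open import Data.Fin using (Fin; _≟_)
open import Data.Fin.Properties using (any?)
open import Data.Bool using (Bool; true; false)
import Data.Bool as Bool
open import Data.Product using (_×_; ∃-syntax; _,_)
open import Function using (flip)
open import Relation.Nullary using (¬_; Dec; does)
open import Relation.Nullary.Decidable using (_×-dec_; ¬?; dec-true; dec-false)
open import Relation.Binary.PropositionalEquality using (_≡_; _≢_; refl; trans; sym)
import Data.List.Membership.DecPropositional as DecMembership

module RowLabel {n : ℕ} (O : Fin n → Fin n → Set)
                (O? : ∀ b b' → Dec (O b b')) (A : Fin n → Fin n → Bool) where

  HasLabel : Bool → Fin n → Set
  HasLabel a b = ∃[ b' ] (O b b' × A b b' ≡ a)

  Mixed : Fin n → Set
  Mixed b = HasLabel true b × HasLabel false b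

  rowLabel : Fin n → Bool
  rowLabel b = does (any? λ b' → O? b b' ×-dec (A b b' Bool.≟ true))

  rowLabel-correct : ∀ {b b'} → ¬ Mixed b → O b b' → rowLabel b ≡ A b b'
  rowLabel-correct {b} {b'} pure o with A b b' in eq
  ... | true  = dec-true (any? _) (b' , o , eq)
  ... | false = dec-false (any? _) λ hasTrue → pure (hasTrue , b' , o , eq)

module _ {n : ℕ} (N : NetworkGraph n) (x : Fin n) where
  open NetworkGraph N

  onPath? : ∀ b b' → Dec (OnPath N x b b')
  onPath? b b' = (boundary b Bool.≟ true) ×-dec (boundary b' Bool.≟ true)
                 ×-dec ¬? (b ≟ b') ×-dec (x ∈? path b b')
    where open DecMembership (_≟_ {n}) using (_∈?_)

  module Rows (A : Fin n → Fin n → Bool) =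
    RowLabel (OnPath N x) onPath? A
  module Columns (A : Fin n → Fin n → Bool) =
    RowLabel (flip (OnPath N x)) (flip onPath?) (flip A)

  mixedSource : ∀ A b → Rows.Mixed A b → S¹ N x A b × S² N x A b
  mixedSource A b ((c , o , t) , (d , o' , f)) =
    ((c , o) , c , (b , o) , o , t) , ((d , o') , d , (b , o') , o' , f)

  mixedReceiver : ∀ A b' → Columns.Mixed A b' → R¹ N x A b' × R² N x A b'
  mixedReceiver A b' ((c , o , t) , (d , o' , f)) =
    ((c , o) , c , (b' , o) , o , t) , ((d , o') , d , (b' , o') , o' , f)

lemma3p1 : {n : ℕ} (N : NetworkGraph n) (x : Fin n) →
    Internal N x → NonSeparable N x →
    (A : Fin n → Fin n → Bool) →
    (∃[ b ] ∃[ b' ] (OnPath N x b b' × A b b' ≡ true)) →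
    (∃[ b ] ∃[ b' ] (OnPath N x b b' × A b b' ≡ false)) →
    ¬ ((∀ b → ¬ (S¹ N x A b × S² N x A b)) × (∀ b' → ¬ (R¹ N x A b' × R² N x A b')))
lemma3p1 N x _ nonSeparable A (b₁ , b₁' , o₁ , t) (b₂ , b₂' , o₂ , f) (noS , noR) =
  nonSeparable (σ , ρ , (b₁ , (b₁' , o₁) , σ≡ o₁ t) , (b₂ , (b₂' , o₂) , σ≡ o₂ f)
                      , (b₁' , (b₁ , o₁) , ρ≡ o₁ t) , (b₂' , (b₂ , o₂) , ρ≡ o₂ f)
                      , noCrossing)
  where
  open Rows N x A using (rowLabel; rowLabel-correct)
  open Columns N x A renaming (rowLabel to columnLabel; rowLabel-correct to columnLabel-correct)

  σ ρ : Fin _ → Bool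
  σ = rowLabel
  ρ = columnLabel

  σ≡ : ∀ {b b' a} → OnPath N x b b' → A b b' ≡ a → σ b ≡ a
  σ≡ {b} o eq = trans (rowLabel-correct (λ m → noS b (mixedSource N x A b m)) o) eq

  ρ≡ : ∀ {b b' a} → OnPath N x b b' → A b b' ≡ a → ρ b' ≡ a
  ρ≡ {b' = b'} o eq =
    trans (columnLabel-correct (λ m → noR b' (mixedReceiver N x A b' m)) o) eq

  noCrossing : ∀ b b' → InS N x b → InR N x b' → σ b ≢ ρ b' → ¬ OnPath N x b b'
  noCrossing b b' _ _ σ≢ρ o = σ≢ρ (trans (σ≡ o refl) (sym (ρ≡ o refl)))
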